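{- Let $x,y\in\mathbf{N}=\{1,2,3,\ldots\}$ with $y\neq x$, and suppose that $y+1$ is a term of the sequence $\gamma_\star(x)=\langle \star^k x+1\rangle_{k=0}^\infty$. Then $y^\star$ is a proper suffix of $x^\star$, and no prime that divides a term of the prefix of $x^\star$ complementary to $y^\star$ divides any term of $y^\star$.
   Context: Define $\star:\mathbf{N}\to\mathbf{N}$ by $\star x=x(x+1)$; $\star^0$ is the identity and $\star^{k+1}=\star^k\circ\star$. For $x\in\mathbf{N}$, the gross $x$-sequence is $\gamma_\star(x)=\langle x+1,\ \star x+1,\ \star^2x+1,\ldots\rangle=\langle \star^kx+1\rangle_{k=0}^\infty$. The star sequence $x^\star$ is obtained from $\gamma_\star(x)$ as follows: each term $\star^kx+1$ is written as $p_1^{e_1}p_2^{e_2}\cdots p_r^{e_r}$ with primes $p_1<p_2<\cdots<p_r$ and $e_i\ge1$, and is replaced by the finite list $p_1^{e_1},p_2^{e_2},\ldots,p_r^{e_r}$; concatenating these lists in order of $k=0,1,2,\ldots$ gives the sequence $x^\star$ of prime powers. -}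

module Defs where

open import Data.Nat using (ℕ; zero; suc; _+_; _*_; _^_; _⊔_)
open import Data.Nat.Divisibility using (_∣_; _∣?_)
open import Data.Nat.Primality using (Prime; prime?)
open import Data.List using (List; []; _∷_; map; filter; upTo; foldr; concatMap)
open import Function using (_∘_)

star : ℕ → ℕ
star x = x * (x + 1)

starIter : ℕ → ℕ → ℕ
starIter zero    x = x
starIter (suc k) x = starIter k (star x)

gross : ℕ → ℕ → ℕ
gross x k = starIter k x + 1

-- exponent of p in n (n ≥ 1, p ≥ 2): the largest e ≤ n with p^e ∣ n
expo : ℕ → ℕ → ℕ
expo p n = foldr _⊔_ 0 (filter (λ e → (p ^ e) ∣? n) (upTo (suc n)))

primeDivisors : ℕ → List ℕ
primeDivisors n = filter (λ p → p ∣? n) (filter prime? (upTo (suc n)))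

-- n = p₁^e₁ ⋯ p_r^e_r (p₁ < ⋯ < p_r) replaced by the list p₁^e₁, …, p_r^e_r
primePowerList : ℕ → List ℕ
primePowerList n = map (λ p → p ^ expo p n) (primeDivisors n)

nthOr0 : List ℕ → ℕ → ℕ
nthOr0 []       _       = 0
nthOr0 (a ∷ as) zero    = a
nthOr0 (a ∷ as) (suc i) = nthOr0 as i

-- the star sequence x⋆ as a function ℕ → ℕ (0-indexed).
-- For x ≥ 1 every block primePowerList (⋆^k x + 1) is nonempty (⋆^k x + 1 ≥ 2),
-- so the i-th entry of the concatenation lies within blocks 0,…,i.
starSeq : ℕ → ℕ → ℕ
starSeq x i = nthOr0 (concatMap (primePowerList ∘ gross x) (upTo (suc i))) i

{-# OPTIONS --safe #-}
-- x⋆ is the concatenation of the blocks primePowerList (⋆ᵏx + 1), all nonempty. If y = ⋆ᵏx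
-- with k ≥ 1 then ⋆ʲy = ⋆ᵏ⁺ʲx, so y⋆ is x⋆ with its first k blocks removed. An entry of those
-- blocks divides some ⋆ᵃx + 1 with a < k, which divides ⋆ᵃ⁺¹x = ⋆ᵃx (⋆ᵃx + 1) and hence y and
-- every ⋆ᵇy, whereas an entry of y⋆ divides some ⋆ᵇy + 1.
module Submission where

open import Defs
open import Data.Nat using (ℕ; zero; suc; _+_; _^_; _⊔_; _∸_; _≤_; _<_; z≤n; s≤s)
open import Data.Nat.Properties
  using (+-cancelʳ-≡; +-mono-≤; +-monoˡ-≤; ⊔-sel; m≤n+m; m+[n∸m]≡n; ≤-trans)
open import Data.Nat.Divisibility
  using (_∣_; _∣?_; 1∣_; ∣-refl; ∣-trans; ∣⇒≤; ∣1⇒≡1; ∣m+n∣m⇒∣n; m∣m*n; n∣m*n)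
open import Data.Nat.Primality using (Prime; prime?; ¬prime[1])
open import Data.Nat.Primality.Factorisation using (factorise)
open import Data.Nat.Coprimality using (Coprime)
open import Data.Nat.ListAction using (product)
open import Data.List using (List; []; _∷_; _++_; length; upTo; concatMap; applyUpTo)
open import Data.List.Properties using (++-assoc; length-++; length-map; foldr-preservesᵇ)
open import Data.List.Relation.Unary.All using (_∷_)
open import Data.List.Relation.Unary.All.Properties using (all-filter)
open import Data.List.Relation.Unary.Any using (here; there)
open import Data.List.Membership.Propositional using (_∈_)
open import Data.List.Membership.Propositional.Properties using (∈-map⁻; ∈-++⁻; ∈-filter⁺; ∈-upTo⁺)
open import Data.Product using (Σ; ∃; _×_; _,_)
open import Data.Sum using (inj₁; inj₂)
open import Data.Empty using (⊥-elim)
open import Function using (_∘_; id)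
open import Relation.Nullary using (¬_)
open import Relation.Binary.PropositionalEquality
  using (_≡_; _≢_; refl; sym; trans; cong; cong₂; subst; module ≡-Reasoning)

nthOr0-++ˡ : ∀ xs ys {i} → i < length xs → nthOr0 (xs ++ ys) i ≡ nthOr0 xs i
nthOr0-++ˡ (x ∷ xs) ys {zero}  _         = refl
nthOr0-++ˡ (x ∷ xs) ys {suc i} (s≤s i<n) = nthOr0-++ˡ xs ys i<n

nthOr0-++ʳ : ∀ xs ys i → nthOr0 (xs ++ ys) (length xs + i) ≡ nthOr0 ys i
nthOr0-++ʳ []       ys i = refl
nthOr0-++ʳ (x ∷ xs) ys i = nthOr0-++ʳ xs ys i

nthOr0-∈ : ∀ xs {i} → i < length xs → nthOr0 xs i ∈ xs
nthOr0-∈ (x ∷ xs) {zero}  _         = here refl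
nthOr0-∈ (x ∷ xs) {suc i} (s≤s i<n) = there (nthOr0-∈ xs i<n)

blocks : (ℕ → List ℕ) → ℕ → List ℕ
blocks B zero    = []
blocks B (suc n) = B 0 ++ blocks (B ∘ suc) n

flatten : (ℕ → List ℕ) → ℕ → ℕ
flatten B i = nthOr0 (blocks B (suc i)) i

NonEmptyBlocks : (ℕ → List ℕ) → Set
NonEmptyBlocks B = ∀ j → 0 < length (B j)

concatMap-applyUpTo : ∀ (B : ℕ → List ℕ) f n → concatMap B (applyUpTo f n) ≡ blocks (B ∘ f) n
concatMap-applyUpTo B f zero    = refl
concatMap-applyUpTo B f (suc n) = cong (B (f 0) ++_) (concatMap-applyUpTo B (f ∘ suc) n)

blocks-+ : ∀ B a b → blocks B (a + b) ≡ blocks B a ++ blocks (B ∘ (a +_)) b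
blocks-+ B zero    b = refl
blocks-+ B (suc a) b = begin
  B 0 ++ blocks (B ∘ suc) (a + b)                          ≡⟨ cong (B 0 ++_) (blocks-+ (B ∘ suc) a b) ⟩
  B 0 ++ (blocks (B ∘ suc) a ++ blocks (B ∘ (suc a +_)) b) ≡⟨ sym (++-assoc (B 0) _ _) ⟩
  blocks B (suc a) ++ blocks (B ∘ (suc a +_)) b            ∎
  where open ≡-Reasoning

blocks-cong : ∀ {B C} → (∀ j → B j ≡ C j) → ∀ n → blocks B n ≡ blocks C n
blocks-cong B≗C zero    = refl
blocks-cong B≗C (suc n) = cong₂ _++_ (B≗C 0) (blocks-cong (B≗C ∘ suc) n)

∈-blocks⁻ : ∀ B n {z} → z ∈ blocks B n → ∃ λ j → j < n × z ∈ B j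
∈-blocks⁻ B (suc n) z∈ with ∈-++⁻ (B 0) z∈
... | inj₁ z∈B₀ = 0 , s≤s z≤n , z∈B₀
... | inj₂ z∈Bs with ∈-blocks⁻ (B ∘ suc) n z∈Bs
...   | j , j<n , z∈Bⱼ = suc j , s≤s j<n , z∈Bⱼ

length-blocks : ∀ B → NonEmptyBlocks B → ∀ n → n ≤ length (blocks B n)
length-blocks B ne zero    = z≤n
length-blocks B ne (suc n) = subst (suc n ≤_) (sym (length-++ (B 0)))
  (+-mono-≤ (ne 0) (length-blocks (B ∘ suc) (ne ∘ suc) n))

nthOr0-blocks : ∀ B → NonEmptyBlocks B → ∀ {i n} → i < n → nthOr0 (blocks B n) i ≡ flatten B i
nthOr0-blocks B ne {i} {n} i<n = begin
  nthOr0 (blocks B n) i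
    ≡⟨ cong (λ l → nthOr0 (blocks B l) i) (sym (m+[n∸m]≡n i<n)) ⟩
  nthOr0 (blocks B (suc i + d)) i
    ≡⟨ cong (λ l → nthOr0 l i) (blocks-+ B (suc i) d) ⟩
  nthOr0 (blocks B (suc i) ++ blocks (B ∘ (suc i +_)) d) i
    ≡⟨ nthOr0-++ˡ (blocks B (suc i)) _ (length-blocks B ne (suc i)) ⟩
  flatten B i ∎
  where
  open ≡-Reasoning
  d = n ∸ suc i

flatten-prefix : ∀ B → NonEmptyBlocks B → ∀ k {i} → i < length (blocks B k) →
  flatten B i ≡ nthOr0 (blocks B k) i
flatten-prefix B ne k {i} i<m = begin
  flatten B i                                          ≡⟨ sym (nthOr0-blocks B ne (m≤n+m (suc i) k)) ⟩
  nthOr0 (blocks B (k + suc i)) i                      ≡⟨ cong (λ l → nthOr0 l i) (blocks-+ B k (suc i)) ⟩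
  nthOr0 (blocks B k ++ blocks (B ∘ (k +_)) (suc i)) i ≡⟨ nthOr0-++ˡ (blocks B k) _ i<m ⟩
  nthOr0 (blocks B k) i                                ∎
  where open ≡-Reasoning

flatten-suffix : ∀ B → NonEmptyBlocks B → ∀ k i →
  flatten B (length (blocks B k) + i) ≡ flatten (B ∘ (k +_)) i
flatten-suffix B ne k i = begin
  flatten B (m + i)
    ≡⟨ sym (nthOr0-blocks B ne (m≤n+m (suc (m + i)) k)) ⟩
  nthOr0 (blocks B (k + n)) (m + i)
    ≡⟨ cong (λ l → nthOr0 l (m + i)) (blocks-+ B k n) ⟩
  nthOr0 (blocks B k ++ blocks (B ∘ (k +_)) n) (m + i)
    ≡⟨ nthOr0-++ʳ (blocks B k) _ i ⟩
  nthOr0 (blocks (B ∘ (k +_)) n) i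
    ≡⟨ nthOr0-blocks (B ∘ (k +_)) (ne ∘ (k +_)) (s≤s (m≤n+m i m)) ⟩
  flatten (B ∘ (k +_)) i ∎
  where
  open ≡-Reasoning
  m = length (blocks B k)
  n = suc (m + i)

flatten-∈ : ∀ B → NonEmptyBlocks B → ∀ i → ∃ λ j → flatten B i ∈ B j
flatten-∈ B ne i
  with ∈-blocks⁻ B (suc i) (nthOr0-∈ (blocks B (suc i)) (length-blocks B ne (suc i)))
... | j , _ , z∈Bⱼ = j , z∈Bⱼ

flatten-prefix-∈ : ∀ B → NonEmptyBlocks B → ∀ k {i} → i < length (blocks B k) →
  ∃ λ j → j < k × flatten B i ∈ B j
flatten-prefix-∈ B ne k i<m =
  ∈-blocks⁻ B k (subst (_∈ blocks B k) (sym (flatten-prefix B ne k i<m)) (nthOr0-∈ (blocks B k) i<m))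

starIter-+ : ∀ a b x → starIter (a + b) x ≡ starIter b (starIter a x)
starIter-+ zero    b x = refl
starIter-+ (suc a) b x = starIter-+ a b (star x)

starIter-suc : ∀ a x → starIter (suc a) x ≡ star (starIter a x)
starIter-suc zero    x = refl
starIter-suc (suc a) x = starIter-suc a (star x)

∣-starIter : ∀ n x → x ∣ starIter n x
∣-starIter zero    x = ∣-refl
∣-starIter (suc n) x = ∣-trans (m∣m*n (x + 1)) (∣-starIter n (star x))

starIter-pos : ∀ n {x} → 0 < x → 0 < starIter n x
starIter-pos zero    0<x       = 0<x
starIter-pos (suc n) (s≤s z≤n) = starIter-pos n (s≤s z≤n)

gross-starIter : ∀ x k j → gross x (k + j) ≡ gross (starIter k x) j
gross-starIter x k j = cong (_+ 1) (starIter-+ k j x)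

gross-∣-starIter : ∀ x {a k} → a < k → gross x a ∣ starIter k x
gross-∣-starIter x {a} {k} a<k =
  subst (gross x a ∣_) ⋆ᵏx≡ (∣-trans gross∣⋆ᵃ⁺¹x (∣-starIter (k ∸ suc a) _))
  where
  gross∣⋆ᵃ⁺¹x : gross x a ∣ starIter (suc a) x
  gross∣⋆ᵃ⁺¹x = subst (gross x a ∣_) (sym (starIter-suc a x)) (n∣m*n (starIter a x))
  ⋆ᵏx≡ : starIter (k ∸ suc a) (starIter (suc a) x) ≡ starIter k x
  ⋆ᵏx≡ = trans (sym (starIter-+ (suc a) (k ∸ suc a) x)) (cong (λ n → starIter n x) (m+[n∸m]≡n a<k))

gross-coprime : ∀ x {a k} → a < k → ∀ b → Coprime (gross x a) (gross (starIter k x) b)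
gross-coprime x {k = k} a<k b (d∣gxa , d∣gyb) = ∣1⇒≡1 (∣m+n∣m⇒∣n d∣gyb d∣⋆ᵇy)
  where
  d∣⋆ᵇy : _ ∣ starIter b (starIter k x)
  d∣⋆ᵇy = ∣-trans d∣gxa (∣-trans (gross-∣-starIter x a<k) (∣-starIter b (starIter k x)))

^expo-∣ : ∀ p n → p ^ expo p n ∣ n
^expo-∣ p n = foldr-preservesᵇ {P = λ e → p ^ e ∣ n} (λ {a} {b} → ⊔-preserves a b)
  (1∣ n) (all-filter (λ e → p ^ e ∣? n) (upTo (suc n)))
  where
  ⊔-preserves : ∀ a b → p ^ a ∣ n → p ^ b ∣ n → p ^ (a ⊔ b) ∣ n
  ⊔-preserves a b pᵃ∣n pᵇ∣n with ⊔-sel a b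
  ... | inj₁ a⊔b≡a = subst (λ e → p ^ e ∣ n) (sym a⊔b≡a) pᵃ∣n
  ... | inj₂ a⊔b≡b = subst (λ e → p ^ e ∣ n) (sym a⊔b≡b) pᵇ∣n

∈-primePowerList⇒∣ : ∀ n {q} → q ∈ primePowerList n → q ∣ n
∈-primePowerList⇒∣ n q∈ with ∈-map⁻ (λ p → p ^ expo p n) q∈
... | p , _ , refl = ^expo-∣ p n

∃-prime-divisor : ∀ n → 2 ≤ n → ∃ λ q → Prime q × q ∣ n
∃-prime-divisor 1 (s≤s ())
∃-prime-divisor n@(suc (suc _)) _ with factorise n
... | record { factors = [] ; isFactorisation = () }
... | record { factors = q ∷ qs ; isFactorisation = n≡Πqs ; factorsPrime = prime[q] ∷ _ } =
  q , prime[q] , subst (q ∣_) (sym n≡Πqs) (m∣m*n (product qs))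

primePowerList-nonempty : ∀ n → 2 ≤ n → 0 < length (primePowerList n)
primePowerList-nonempty n@(suc _) 2≤n with ∃-prime-divisor n 2≤n
... | q , prime[q] , q∣n = subst (0 <_) (sym (length-map _ (primeDivisors n)))
  (∈⇒length-pos (∈-filter⁺ (_∣? n) (∈-filter⁺ prime? (∈-upTo⁺ (s≤s (∣⇒≤ q∣n))) prime[q]) q∣n))
  where
  ∈⇒length-pos : ∀ {xs} → q ∈ xs → 0 < length xs
  ∈⇒length-pos (here _)  = s≤s z≤n
  ∈⇒length-pos (there _) = s≤s z≤n

starBlock : ℕ → ℕ → List ℕ
starBlock x = primePowerList ∘ gross x

starBlock-nonempty : ∀ {x} → 0 < x → NonEmptyBlocks (starBlock x)
starBlock-nonempty {x} 0<x j = primePowerList-nonempty (gross x j) (+-monoˡ-≤ 1 (starIter-pos j 0<x))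

starSeq-flatten : ∀ x i → starSeq x i ≡ flatten (starBlock x) i
starSeq-flatten x i = cong (λ l → nthOr0 l i) (concatMap-applyUpTo (starBlock x) id (suc i))

starSeq-∣-gross : ∀ {x} → 0 < x → ∀ i → ∃ λ b → starSeq x i ∣ gross x b
starSeq-∣-gross {x} 0<x i with flatten-∈ (starBlock x) (starBlock-nonempty 0<x) i
... | b , z∈ =
  b , subst (_∣ gross x b) (sym (starSeq-flatten x i)) (∈-primePowerList⇒∣ (gross x b) z∈)

starSeq-prefix-∣-gross : ∀ {x} → 0 < x → ∀ k {i} → i < length (blocks (starBlock x) k) →
  ∃ λ a → a < k × starSeq x i ∣ gross x a
starSeq-prefix-∣-gross {x} 0<x k {i} i<m
  with flatten-prefix-∈ (starBlock x) (starBlock-nonempty 0<x) k i<m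
... | a , a<k , z∈ =
  a , a<k , subst (_∣ gross x a) (sym (starSeq-flatten x i)) (∈-primePowerList⇒∣ (gross x a) z∈)

starSeq-suffix : ∀ {x} → 0 < x → ∀ k i →
  starSeq x (length (blocks (starBlock x) k) + i) ≡ starSeq (starIter k x) i
starSeq-suffix {x} 0<x k i = begin
  starSeq x (m + i)                    ≡⟨ starSeq-flatten x (m + i) ⟩
  flatten (starBlock x) (m + i)        ≡⟨ flatten-suffix (starBlock x) (starBlock-nonempty 0<x) k i ⟩
  flatten (starBlock x ∘ (k +_)) i     ≡⟨ cong (λ l → nthOr0 l i) (blocks-cong tail≗ (suc i)) ⟩
  flatten (starBlock (starIter k x)) i ≡⟨ sym (starSeq-flatten (starIter k x) i) ⟩
  starSeq (starIter k x) i             ∎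
  where
  open ≡-Reasoning
  m = length (blocks (starBlock x) k)
  tail≗ : ∀ j → starBlock x (k + j) ≡ starBlock (starIter k x) j
  tail≗ j = cong primePowerList (gross-starIter x k j)

starSeq-prefix-coprime : ∀ {x} → 0 < x → ∀ k {i} → i < length (blocks (starBlock x) k) →
  ∀ j → Coprime (starSeq x i) (starSeq (starIter k x) j)
starSeq-prefix-coprime {x} 0<x k i<m j (d∣xᵢ , d∣yⱼ)
  with starSeq-prefix-∣-gross 0<x k i<m | starSeq-∣-gross (starIter-pos k 0<x) j
... | a , a<k , xᵢ∣ | b , yⱼ∣ = gross-coprime x a<k b (∣-trans d∣xᵢ xᵢ∣ , ∣-trans d∣yⱼ yⱼ∣)

proposition1 : (x y : ℕ) → 0 < x → 0 < y → y ≢ x →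
    Σ ℕ (λ k → y + 1 ≡ gross x k) →
    Σ ℕ (λ m → 0 < m
      × ((i : ℕ) → starSeq x (m + i) ≡ starSeq y i)
      × ((p : ℕ) → Prime p → (i : ℕ) → i < m → p ∣ starSeq x i →
           (j : ℕ) → ¬ (p ∣ starSeq y j)))
proposition1 x y 0<x _ y≢x (k , y+1≡) with +-cancelʳ-≡ 1 y (starIter k x) y+1≡
proposition1 x _ 0<x _ x≢x (zero , _) | refl = ⊥-elim (x≢x refl)
proposition1 x _ 0<x _ _ (k@(suc _) , _) | refl = m , 0<m , starSeq-suffix 0<x k , disjoint
  where
  m = length (blocks (starBlock x) k)
  0<m : 0 < m
  0<m = ≤-trans (s≤s z≤n) (length-blocks (starBlock x) (starBlock-nonempty 0<x) k)
  disjoint : ∀ p → Prime p → ∀ i → i < m → p ∣ starSeq x i → ∀ j → ¬ (p ∣ starSeq (starIter k x) j)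
  disjoint p prime[p] i i<m p∣xᵢ j p∣yⱼ =
    ¬prime[1] (subst Prime (starSeq-prefix-coprime 0<x k i<m j (p∣xᵢ , p∣yⱼ)) prime[p])
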